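{- Let $G$ be a graph and let $P$ be a path in $G$ with at least $4$ edges between vertices $u$ and $v$, all of whose internal vertices have degree $2$ in $G$. Consider an orientation of a subset of the edges of $G$ in which no vertex is a sink or a source, and in which no undirected edge of $P$ can be directed (in either direction) without creating a sink or a source. For $x\in\{u,v\}$ let $e_x$ be the edge of $P$ incident to $x$, and assume that whenever $e_x$ is undirected, all other edges incident to $x$ are directed and either all point into $x$ or all point out of $x$. Define the signal $s_x\in\{1,-1\}$ as follows: if $e_x$ is directed (explicit signal), $s_x=1$ if $e_x$ points into $x$ and $s_x=-1$ if it points out of $x$; if $e_x$ is undirected (implicit signal), $s_x=-1$ if the other edges at $x$ all point into $x$ and $s_x=1$ if they all point out of $x$. Then the number of undirected edges of $P$ is odd if $s_u=s_v$ and even if $s_u\neq s_v$; that is, the parity is the same as it would be if both signals were explicit.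
   Context: A vertex is a sink if all edges incident to it are directed into it, and a source if all edges incident to it are directed out of it. An implicit signal at $x$ records the direction that the undirected edge $e_x$ would have to take at $x$ to avoid a sink or source at $x$, given the other edges at $x$. -}

module Defs where

open import Data.Nat using (ℕ; zero; suc; _+_; _≤_)
open import Data.Nat.Divisibility using (_∣_)
open import Data.Fin using (Fin; zero; suc; inject₁; fromℕ; _≟_)
open import Data.Bool using (Bool; true; false; _∧_; _∨_; not; T)
open import Data.Empty using (⊥)
open import Data.Product using (Σ; ∃; _×_; _,_)
open import Data.Sum using (_⊎_)
open import Relation.Nullary using (¬_)
open import Relation.Nullary.Decidable using (⌊_⌋)
open import Relation.Binary.PropositionalEquality using (_≡_; _≢_)
open import Function.Definitions using (Injective)

record Graph (n : ℕ) : Set where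
  field
    Adj    : Fin n → Fin n → Bool
    sym    : ∀ x y → Adj x y ≡ Adj y x
    irrefl : ∀ x → Adj x x ≡ false
open Graph public

toℕ : Bool → ℕ
toℕ true  = 1
toℕ false = 0

count : ∀ {k} → (Fin k → Bool) → ℕ
count {zero}  f = 0
count {suc k} f = toℕ (f zero) + count (λ i → f (suc i))

degree : ∀ {n} → Graph n → Fin n → ℕ
degree G x = count (λ y → Adj G x y)

record Path {n : ℕ} (G : Graph n) (k : ℕ) : Set where
  field
    vtx      : Fin (suc k) → Fin n
    distinct : Injective _≡_ _≡_ vtx
    adjacent : ∀ (i : Fin k) → T (Adj G (vtx (inject₁ i)) (vtx (suc i)))
open Path public

-- An arc relation: D x y = true means "the edge xy is directed x → y".
Arcs : ℕ → Set
Arcs n = Fin n → Fin n → Bool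

IsPartialOrientation : ∀ {n} → Graph n → Arcs n → Set
IsPartialOrientation {n} G D =
  (∀ x y → T (D x y) → T (Adj G x y)) ×
  (∀ x y → T (D x y) → T (D y x) → ⊥)

Directed : ∀ {n} → Arcs n → Fin n → Fin n → Set
Directed D x y = T (D x y ∨ D y x)

Undirectedᵇ : ∀ {n} → Graph n → Arcs n → Fin n → Fin n → Bool
Undirectedᵇ G D x y = Adj G x y ∧ not (D x y) ∧ not (D y x)

Undirected : ∀ {n} → Graph n → Arcs n → Fin n → Fin n → Set
Undirected G D x y = T (Undirectedᵇ G D x y)

Sink : ∀ {n} → Graph n → Arcs n → Fin n → Set
Sink G D x = ∀ y → T (Adj G x y) → T (D y x)

Source : ∀ {n} → Graph n → Arcs n → Fin n → Set
Source G D x = ∀ y → T (Adj G x y) → T (D x y)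

NoSinkNoSource : ∀ {n} → Graph n → Arcs n → Set
NoSinkNoSource G D = ∀ x → ¬ Sink G D x × ¬ Source G D x

addArc : ∀ {n} → Arcs n → Fin n → Fin n → Arcs n
addArc D a b x y = D x y ∨ (⌊ x ≟ a ⌋ ∧ ⌊ y ≟ b ⌋)

CreatesSinkOrSource : ∀ {n} → Graph n → Arcs n → Fin n → Fin n → Set
CreatesSinkOrSource G D a b =
  ∃ λ z → Sink G (addArc D a b) z ⊎ Source G (addArc D a b) z

OthersIn : ∀ {n} → Graph n → Arcs n → Fin n → Fin n → Set
OthersIn G D x y = ∀ w → w ≢ y → T (Adj G x w) → T (D w x)

OthersOut : ∀ {n} → Graph n → Arcs n → Fin n → Fin n → Set
OthersOut G D x y = ∀ w → w ≢ y → T (Adj G x w) → T (D x w)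

HasOtherEdge : ∀ {n} → Graph n → Fin n → Fin n → Set
HasOtherEdge G x y = ∃ λ w → w ≢ y × T (Adj G x w)

data Sign : Set where
  plus minus : Sign

-- Signal G D x y s : the signal at x (with e_x = xy) is s.
data Signal {n : ℕ} (G : Graph n) (D : Arcs n) (x y : Fin n) : Sign → Set where
  explicit-in   : T (D y x) → Signal G D x y plus
  explicit-out  : T (D x y) → Signal G D x y minus
  implicit-in   : Undirected G D x y → HasOtherEdge G x y →
                  OthersIn G D x y → Signal G D x y minus
  implicit-out  : Undirected G D x y → HasOtherEdge G x y →
                  OthersOut G D x y → Signal G D x y plus

Even Odd : ℕ → Set
Even m = 2 ∣ m
Odd  m = ¬ (2 ∣ m)

numUndirected : ∀ {n k} (G : Graph n) → Arcs n → Path G k → ℕ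
numUndirected G D P =
  count (λ i → Undirectedᵇ G D (vtx P (inject₁ i)) (vtx P (suc i)))

Internal : ∀ {k} → Fin (suc k) → Set
Internal {k} i = i ≢ zero × i ≢ fromℕ k

-- Read the states of the edges of P in path order: forward, backward or undirected.
-- At an internal vertex of degree 2 two directed path edges must point the same way,
-- and an undirected edge that cannot be directed either way lies between two directed
-- edges pointing in opposite ways.  So every undirected edge reverses the direction,
-- and the parity of their number is decided by the directions at the two ends.  An
-- implicit signal behaves like an explicit one placed just before the undirected end
-- edge: the only way to block that edge is through the next edge of the path, which
-- then points as the virtual explicit signal predicts.
module Submission where

open import Defs hiding (sym)
open import Data.Nat using (ℕ; zero; suc; _+_)
open import Data.Nat.Properties using (+-comm; +-assoc; +-suc)
open import Data.Nat.Divisibility using (_∣_; _∣0; ∣-refl; ∣m∣n⇒∣m+n; ∣m+n∣m⇒∣n; ∣1⇒≡1)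
open import Data.Fin using (Fin; zero; suc; inject₁; fromℕ; _≟_)
open import Data.Fin.Properties using (suc-injective; fromℕ≢inject₁)
open import Data.Bool using (Bool; true; false; _∧_; not; T)
open import Data.Bool.Properties using (∧-comm; T-∧; T-∨)
open import Data.Unit using (⊤; tt)
open import Data.Empty using (⊥; ⊥-elim)
open import Data.Product using (∃-syntax; _×_; _,_; proj₁; proj₂)
open import Data.Sum using (_⊎_; inj₁; inj₂)
open import Function using (_∘_)
open import Function.Bundles using (Equivalence)
open import Relation.Binary.PropositionalEquality
  using (_≡_; _≢_; refl; sym; trans; cong; cong₂; subst; module ≡-Reasoning)
open import Relation.Nullary using (¬_; yes; no; does)
open import Relation.Nullary.Decidable using (⌊_⌋; toWitness; dec-false)

data Dir : Set where
  forward backward : Dir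

opp : Dir → Dir
opp forward  = backward
opp backward = forward

opp-involutive : ∀ a → opp (opp a) ≡ a
opp-involutive forward  = refl
opp-involutive backward = refl

opp-≢ : ∀ a → a ≢ opp a
opp-≢ forward  ()
opp-≢ backward ()

oppⁿ : ℕ → Dir → Dir
oppⁿ zero    a = a
oppⁿ (suc n) a = oppⁿ n (opp a)

oppⁿ-+ : ∀ m n a → oppⁿ (m + n) a ≡ oppⁿ n (oppⁿ m a)
oppⁿ-+ zero    n a = refl
oppⁿ-+ (suc m) n a = oppⁿ-+ m n (opp a)

even-suc⇒odd : ∀ {n} → Even (suc n) → Odd n
even-suc⇒odd {n} 2∣1+n 2∣n with ∣1⇒≡1 (∣m+n∣m⇒∣n (subst (2 ∣_) (+-comm 1 n) 2∣1+n) 2∣n)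
... | ()

oppⁿ-even-or-odd : ∀ n a → (Even n × oppⁿ n a ≡ a) ⊎ (Even (suc n) × oppⁿ n a ≡ opp a)
oppⁿ-even-or-odd zero    a = inj₁ (2 ∣0 , refl)
oppⁿ-even-or-odd (suc n) a with oppⁿ-even-or-odd n (opp a)
... | inj₁ (even , eq) = inj₂ (∣m∣n⇒∣m+n ∣-refl even , eq)
... | inj₂ (even , eq) = inj₁ (even , trans eq (opp-involutive a))

oppⁿ-parity : ∀ n {a b} → oppⁿ n (opp a) ≡ b → (a ≡ b → Odd n) × (a ≢ b → Even n)
oppⁿ-parity n {a} refl with oppⁿ-even-or-odd n (opp a)
... | inj₁ (even , eq) = (λ a≡b → ⊥-elim (opp-≢ a (trans a≡b eq))) , λ _ → even
... | inj₂ (even , eq) =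
  (λ _ → even-suc⇒odd even) , λ a≢b → ⊥-elim (a≢b (sym (trans eq (opp-involutive a))))

count-cong : ∀ {k} {f g : Fin k → Bool} → (∀ i → f i ≡ g i) → count f ≡ count g
count-cong {zero}  f≗g = refl
count-cong {suc k} f≗g = cong₂ _+_ (cong toℕ (f≗g zero)) (count-cong (f≗g ∘ suc))

count-last : ∀ {k} (f : Fin (suc k) → Bool) → count f ≡ count (f ∘ inject₁) + toℕ (f (fromℕ k))
count-last {zero}  f = +-comm (toℕ (f zero)) 0
count-last {suc k} f = trans (cong (toℕ (f zero) +_) (count-last (f ∘ suc)))
                             (sym (+-assoc (toℕ (f zero)) _ _))

dropAt : ∀ {k} → (Fin k → Bool) → Fin k → Fin k → Bool
dropAt f a i = not (does (i ≟ a)) ∧ f i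

count-dropAt : ∀ {k} (f : Fin k → Bool) a → T (f a) → count f ≡ suc (count (dropAt f a))
count-dropAt f zero fa with f zero
... | true = refl
count-dropAt f (suc a) fa =
  trans (cong (toℕ (f zero) +_) (count-dropAt (f ∘ suc) a fa)) (+-suc (toℕ (f zero)) _)

dropAt-≢ : ∀ {k} (f : Fin k → Bool) {a i} → i ≢ a → dropAt f a i ≡ f i
dropAt-≢ f {a} {i} i≢a = cong (λ b → not b ∧ f i) (dec-false (i ≟ a) i≢a)

count≡2⇒one-of : ∀ {k} (f : Fin k → Bool) {a b c} → count f ≡ 2 →
  T (f a) → T (f b) → a ≢ b → T (f c) → c ≡ a ⊎ c ≡ b
count≡2⇒one-of f {a} {b} {c} two fa fb a≢b fc with c ≟ a | c ≟ b
... | yes c≡a | _       = inj₁ c≡a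
... | no _    | yes c≡b = inj₂ c≡b
... | no c≢a  | no c≢b  = ⊥-elim (2≢3+ (trans (sym two) three))
  where
  f₁ f₂ : Fin _ → Bool
  f₁ = dropAt f a
  f₂ = dropAt f₁ b
  fb₁ : T (f₁ b)
  fb₁ = subst T (sym (dropAt-≢ f (a≢b ∘ sym))) fb
  fc₂ : T (f₂ c)
  fc₂ = subst T (sym (trans (dropAt-≢ f₁ c≢b) (dropAt-≢ f c≢a))) fc
  three : count f ≡ 3 + count (dropAt f₂ c)
  three = trans (count-dropAt f a fa)
                (cong suc (trans (count-dropAt f₁ b fb₁) (cong suc (count-dropAt f₂ c fc₂))))
  2≢3+ : ∀ {r} → 2 ≢ 3 + r
  2≢3+ ()

data EdgeState : Set where
  directed   : Dir → EdgeState
  undirected : EdgeState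

directed-injective : ∀ {a b} → directed a ≡ directed b → a ≡ b
directed-injective refl = refl

directed≢undirected : ∀ {a} → directed a ≢ undirected
directed≢undirected ()

isUndirected : EdgeState → Bool
isUndirected (directed _) = false
isUndirected undirected   = true

countUndirected : ∀ {k} → (Fin k → EdgeState) → ℕ
countUndirected w = count (isUndirected ∘ w)

countUndirected-directed∷ : ∀ {k a} (w : Fin (suc k) → EdgeState) →
  w zero ≡ directed a → countUndirected w ≡ countUndirected (w ∘ suc)
countUndirected-directed∷ w w₀ =
  cong (λ s → toℕ (isUndirected s) + countUndirected (w ∘ suc)) w₀

countUndirected-undirected∷ : ∀ {k} (w : Fin (suc k) → EdgeState) →
  w zero ≡ undirected → countUndirected w ≡ suc (countUndirected (w ∘ suc))
countUndirected-undirected∷ w w₀ =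
  cong (λ s → toℕ (isUndirected s) + countUndirected (w ∘ suc)) w₀

countUndirected-∷undirected : ∀ {k} (w : Fin (suc k) → EdgeState) →
  w (fromℕ k) ≡ undirected → countUndirected w ≡ countUndirected (w ∘ inject₁) + 1
countUndirected-∷undirected w wₖ =
  trans (count-last (isUndirected ∘ w))
        (cong (λ s → countUndirected (w ∘ inject₁) + toℕ (isUndirected s)) wₖ)

Compatible : EdgeState → EdgeState → Set
Compatible (directed a) (directed b) = a ≡ b
Compatible _            _            = ⊤

compatible : ∀ s t →
  (s ≡ directed forward → t ≡ directed backward → ⊥) →
  (s ≡ directed backward → t ≡ directed forward → ⊥) → Compatible s t
compatible (directed forward)  (directed forward)  _ _ = refl
compatible (directed forward)  (directed backward) f _ = ⊥-elim (f refl refl)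
compatible (directed backward) (directed forward)  _ b = ⊥-elim (b refl refl)
compatible (directed backward) (directed backward) _ _ = refl
compatible (directed _)        undirected          _ _ = tt
compatible undirected          _                   _ _ = tt

NeighboursCompatible : ∀ {k} → (Fin (suc k) → EdgeState) → Set
NeighboursCompatible {k} w = ∀ (j : Fin k) → Compatible (w (inject₁ j)) (w (suc j))

UndirectedBetweenOpposites : ∀ {k} → (Fin (suc k) → EdgeState) → Set
UndirectedBetweenOpposites {zero}  w = ⊤
UndirectedBetweenOpposites {suc k} w = ∀ (j : Fin k) → w (suc (inject₁ j)) ≡ undirected →
  ∃[ a ] w (inject₁ (inject₁ j)) ≡ directed a × w (suc (suc j)) ≡ directed (opp a)

betweenOpposites-tail : ∀ {k} (w : Fin (suc (suc k)) → EdgeState) →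
  UndirectedBetweenOpposites w → UndirectedBetweenOpposites (w ∘ suc)
betweenOpposites-tail {zero}  w rev = tt
betweenOpposites-tail {suc k} w rev = rev ∘ suc

betweenOpposites-init : ∀ {k} (w : Fin (suc (suc k)) → EdgeState) →
  UndirectedBetweenOpposites w → UndirectedBetweenOpposites (w ∘ inject₁)
betweenOpposites-init {zero}  w rev = tt
betweenOpposites-init {suc k} w rev = rev ∘ inject₁

compatible-after-directed : ∀ {a} s t → Compatible s t → s ≡ directed a →
  t ≡ directed a ⊎ t ≡ undirected
compatible-after-directed _ (directed _) a≡x refl = inj₁ (cong directed (sym a≡x))
compatible-after-directed _ undirected  _   _    = inj₂ refl

oppⁿ-undirected-directedEnds : ∀ {k} (w : Fin (suc k) → EdgeState) {a b} →
  NeighboursCompatible w → UndirectedBetweenOpposites w →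
  w zero ≡ directed a → w (fromℕ k) ≡ directed b → oppⁿ (countUndirected w) a ≡ b
oppⁿ-undirected-directedEnds {zero} w {a} agree rev w₀ wₖ =
  trans (cong (λ n → oppⁿ n a) (countUndirected-directed∷ w w₀))
        (directed-injective (trans (sym w₀) wₖ))
oppⁿ-undirected-directedEnds {suc k} w {a} agree rev w₀ wₖ
  with compatible-after-directed (w zero) (w (suc zero)) (agree zero) w₀
... | inj₁ w₁ =
  trans (cong (λ n → oppⁿ n a) (countUndirected-directed∷ w w₀))
        (oppⁿ-undirected-directedEnds (w ∘ suc) (agree ∘ suc) (betweenOpposites-tail w rev) w₁ wₖ)
oppⁿ-undirected-directedEnds {suc zero} w {a} agree rev w₀ wₖ | inj₂ w₁ =
  ⊥-elim (directed≢undirected (trans (sym wₖ) w₁))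
oppⁿ-undirected-directedEnds {suc (suc k)} w {a} {b} agree rev w₀ wₖ | inj₂ w₁
  with rev zero w₁
... | x , w₀′ , w₂ with directed-injective (trans (sym w₀) w₀′)
...   | refl = begin
  oppⁿ (countUndirected w) a
    ≡⟨ cong (λ n → oppⁿ n a) (trans (countUndirected-directed∷ w w₀)
                                    (countUndirected-undirected∷ (w ∘ suc) w₁)) ⟩
  oppⁿ (countUndirected (λ i → w (suc (suc i)))) (opp a)
    ≡⟨ oppⁿ-undirected-directedEnds (λ i → w (suc (suc i))) (λ j → agree (suc (suc j)))
         (betweenOpposites-tail (w ∘ suc) (betweenOpposites-tail w rev)) w₂ wₖ ⟩
  b ∎
  where open ≡-Reasoning

-- An undirected end letter whose neighbour points in direction opp a reads as if a
-- letter directed a stood just outside the word.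
Begins : ∀ {k} → (Fin (suc (suc k)) → EdgeState) → Dir → Set
Begins w a = w zero ≡ directed a ⊎ (w zero ≡ undirected × w (suc zero) ≡ directed (opp a))

Ends : ∀ {k} → (Fin (suc (suc k)) → EdgeState) → Dir → Set
Ends {k} w b = w (fromℕ (suc k)) ≡ directed b
  ⊎ (w (fromℕ (suc k)) ≡ undirected × w (inject₁ (fromℕ k)) ≡ directed (opp b))

oppⁿ-undirected-directedStart : ∀ {k} (w : Fin (suc (suc k)) → EdgeState) {a b} →
  NeighboursCompatible w → UndirectedBetweenOpposites w →
  w zero ≡ directed a → Ends w b → oppⁿ (countUndirected w) a ≡ b
oppⁿ-undirected-directedStart w agree rev w₀ (inj₁ wₗ) =
  oppⁿ-undirected-directedEnds w agree rev w₀ wₗ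
oppⁿ-undirected-directedStart w {a} {b} agree rev w₀ (inj₂ (wₗ , wₚ)) = begin
  oppⁿ (countUndirected w) a
    ≡⟨ cong (λ n → oppⁿ n a) (countUndirected-∷undirected w wₗ) ⟩
  oppⁿ (countUndirected (w ∘ inject₁) + 1) a
    ≡⟨ oppⁿ-+ (countUndirected (w ∘ inject₁)) 1 a ⟩
  opp (oppⁿ (countUndirected (w ∘ inject₁)) a)
    ≡⟨ cong opp (oppⁿ-undirected-directedEnds (w ∘ inject₁) (agree ∘ inject₁)
                  (betweenOpposites-init w rev) w₀ wₚ) ⟩
  opp (opp b)
    ≡⟨ opp-involutive b ⟩
  b ∎
  where open ≡-Reasoning

oppⁿ-undirected : ∀ {k} (w : Fin (suc (suc (suc k))) → EdgeState) {a b} →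
  NeighboursCompatible w → UndirectedBetweenOpposites w →
  Begins w a → Ends w b → oppⁿ (countUndirected w) a ≡ b
oppⁿ-undirected w agree rev (inj₁ w₀) wₗ = oppⁿ-undirected-directedStart w agree rev w₀ wₗ
oppⁿ-undirected w {a} agree rev (inj₂ (w₀ , w₁)) wₗ =
  trans (cong (λ n → oppⁿ n a) (countUndirected-undirected∷ w w₀))
        (oppⁿ-undirected-directedStart (w ∘ suc) (agree ∘ suc) (betweenOpposites-tail w rev) w₁ wₗ)

arcState : Bool → Bool → EdgeState
arcState true  _     = directed forward
arcState false true  = directed backward
arcState false false = undirected

stateOf : ∀ {n} → Arcs n → Fin n → Fin n → EdgeState
stateOf D x y = arcState (D x y) (D y x)

arcState-forward : ∀ {p q} → T p → arcState p q ≡ directed forward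
arcState-forward {true} _ = refl

arcState-backward : ∀ {p q} → (T p → T q → ⊥) → T q → arcState p q ≡ directed backward
arcState-backward {true}  {true} anti _ = ⊥-elim (anti tt tt)
arcState-backward {false} {true} _    _ = refl

forward-arcState : ∀ {p q} → arcState p q ≡ directed forward → T p
forward-arcState {true}          _ = tt
forward-arcState {false} {true}  ()
forward-arcState {false} {false} ()

backward-arcState : ∀ {p q} → arcState p q ≡ directed backward → T q
backward-arcState {true}          ()
backward-arcState {false} {true}  _ = tt
backward-arcState {false} {false} ()

arcState-undirected : ∀ {a p q} → T (a ∧ not p ∧ not q) → arcState p q ≡ undirected
arcState-undirected {true} {false} {false} _ = refl

undirected-arcState : ∀ {a p q} → T a → arcState p q ≡ undirected → T (a ∧ not p ∧ not q)
undirected-arcState {true} {true}          _ ()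
undirected-arcState {true} {false} {true}  _ ()
undirected-arcState {true} {false} {false} _ _ = tt

isUndirected-arcState : ∀ {a p q} → T a → isUndirected (arcState p q) ≡ (a ∧ not p ∧ not q)
isUndirected-arcState {true} {true}          _ = refl
isUndirected-arcState {true} {false} {true}  _ = refl
isUndirected-arcState {true} {false} {false} _ = refl

module LocalStructure {n : ℕ} (G : Graph n) (D : Arcs n) where

  adj-sym : ∀ {x y} → T (Adj G x y) → T (Adj G y x)
  adj-sym {x} {y} = subst T (Graph.sym G x y)

  undirected-sym : ∀ {x y} → Undirected G D x y → Undirected G D y x
  undirected-sym {x} {y} =
    subst T (cong₂ _∧_ (Graph.sym G x y) (∧-comm (not (D x y)) (not (D y x))))

  isUndirected-stateOf : ∀ {x y} → T (Adj G x y) →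
    isUndirected (stateOf D x y) ≡ Undirectedᵇ G D x y
  isUndirected-stateOf {x} {y} = isUndirected-arcState {Adj G x y} {D x y} {D y x}

  stateOf-undirected : ∀ {x y} → Undirected G D x y → stateOf D x y ≡ undirected
  stateOf-undirected {x} {y} = arcState-undirected {Adj G x y}

  undirected-stateOf : ∀ {x y} → T (Adj G x y) → stateOf D x y ≡ undirected → Undirected G D x y
  undirected-stateOf = undirected-arcState

  compatible-at-degree-two : NoSinkNoSource G D → ∀ {x w z} → degree G x ≡ 2 →
    T (Adj G x w) → T (Adj G x z) → w ≢ z → Compatible (stateOf D w x) (stateOf D x z)
  compatible-at-degree-two ns {x} {w} {z} deg xw xz w≢z =
    compatible (stateOf D w x) (stateOf D x z)
      (λ wx zx → proj₁ (ns x) (atNeighbours (forward-arcState wx) (backward-arcState zx)))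
      (λ xw xz → proj₂ (ns x) (atNeighbours (backward-arcState xw) (forward-arcState xz)))
    where
    atNeighbours : ∀ {Q : Fin n → Set} → Q w → Q z → ∀ y → T (Adj G x y) → Q y
    atNeighbours qw qz y xy with count≡2⇒one-of (Adj G x) deg xw xz w≢z xy
    ... | inj₁ refl = qw
    ... | inj₂ refl = qz

  newArc : ∀ {a b x y : Fin n} → T (⌊ x ≟ a ⌋ ∧ ⌊ y ≟ b ⌋) → x ≡ a × y ≡ b
  newArc {a} {b} {x} {y} t with Equivalence.to (T-∧ {⌊ x ≟ a ⌋}) t
  ... | x≡a , y≡b = toWitness {a? = x ≟ a} x≡a , toWitness {a? = y ≟ b} y≡b

  addArc-elsewhere : ∀ {a b x y} → ¬ (x ≡ a × y ≡ b) → T (addArc D a b x y) → T (D x y)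
  addArc-elsewhere {a} {b} {x} {y} ne t with Equivalence.to (T-∨ {D x y}) t
  ... | inj₁ old = old
  ... | inj₂ new = ⊥-elim (ne (newArc new))

  created-source-or-sink : NoSinkNoSource G D → ∀ {a b} →
    CreatesSinkOrSource G D a b → OthersOut G D a b ⊎ OthersIn G D b a
  created-source-or-sink ns {a} {b} (z , inj₁ sink) with b ≟ z
  ... | yes refl = inj₂ λ w w≢a bw → addArc-elsewhere (w≢a ∘ proj₁) (sink w bw)
  ... | no b≢z   = ⊥-elim (proj₁ (ns z) λ y zy → addArc-elsewhere (b≢z ∘ sym ∘ proj₂) (sink y zy))
  created-source-or-sink ns {a} {b} (z , inj₂ source) with a ≟ z
  ... | yes refl = inj₁ λ w w≢b aw → addArc-elsewhere (w≢b ∘ proj₂) (source w aw)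
  ... | no a≢z   = ⊥-elim (proj₂ (ns z) λ y zy → addArc-elsewhere (a≢z ∘ sym ∘ proj₁) (source y zy))

  othersIn-othersOut-absurd : IsPartialOrientation G D → ∀ {x y} →
    HasOtherEdge G x y → OthersIn G D x y → OthersOut G D x y → ⊥
  othersIn-othersOut-absurd po (w , w≢y , xw) inˣ outˣ = proj₂ po w _ (inˣ w w≢y xw) (outˣ w w≢y xw)

  othersIn-across : NoSinkNoSource G D → IsPartialOrientation G D → ∀ {x y} →
    CreatesSinkOrSource G D x y → HasOtherEdge G x y → OthersIn G D x y → OthersIn G D y x
  othersIn-across ns po xy other inˣ with created-source-or-sink ns xy
  ... | inj₁ outˣ = ⊥-elim (othersIn-othersOut-absurd po other inˣ outˣ)
  ... | inj₂ inʸ  = inʸ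

  othersOut-across : NoSinkNoSource G D → IsPartialOrientation G D → ∀ {x y} →
    CreatesSinkOrSource G D y x → HasOtherEdge G x y → OthersOut G D x y → OthersOut G D y x
  othersOut-across ns po yx other outˣ with created-source-or-sink ns yx
  ... | inj₁ outʸ = outʸ
  ... | inj₂ inˣ  = ⊥-elim (othersIn-othersOut-absurd po other inˣ outˣ)

  blocked-between-opposites : NoSinkNoSource G D → IsPartialOrientation G D → ∀ {w x y z} →
    CreatesSinkOrSource G D x y × CreatesSinkOrSource G D y x →
    T (Adj G x w) → w ≢ y → T (Adj G y z) → z ≢ x →
    ∃[ a ] stateOf D w x ≡ directed a × stateOf D y z ≡ directed (opp a)
  blocked-between-opposites ns po {w} {x} {y} {z} (xy , yx) xw w≢y yz z≢x
    with created-source-or-sink ns xy | created-source-or-sink ns yx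
  ... | inj₁ outˣ | inj₁ outʸ =
    backward , arcState-backward (proj₂ po w x) (outˣ w w≢y xw) , arcState-forward (outʸ z z≢x yz)
  ... | inj₁ outˣ | inj₂ inˣ  = ⊥-elim (othersIn-othersOut-absurd po (w , w≢y , xw) inˣ outˣ)
  ... | inj₂ inʸ  | inj₁ outʸ = ⊥-elim (othersIn-othersOut-absurd po (z , z≢x , yz) inʸ outʸ)
  ... | inj₂ inʸ  | inj₂ inˣ  =
    forward , arcState-forward (inˣ w w≢y xw) , arcState-backward (proj₂ po y z) (inʸ z z≢x yz)

inject₁²≢suc² : ∀ {m} (j : Fin m) → inject₁ (inject₁ j) ≢ suc (suc j)
inject₁²≢suc² zero    ()
inject₁²≢suc² (suc j) eq = inject₁²≢suc² j (suc-injective eq)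

-- A signal read as a direction along the path: pointing into the far end is forward,
-- so at the near end a signal s corresponds to the direction opp (signDir s).
signDir : Sign → Dir
signDir plus  = forward
signDir minus = backward

signDir-injective : ∀ {s t} → signDir s ≡ signDir t → s ≡ t
signDir-injective {plus}  {plus}  _ = refl
signDir-injective {minus} {minus} _ = refl

module PathStates {n k : ℕ} {G : Graph n} {D : Arcs n}
  (po : IsPartialOrientation G D) (ns : NoSinkNoSource G D) (P : Path G (2 + k)) where

  open LocalStructure G D

  p : Fin (3 + k) → Fin n
  p = vtx P

  edgeState : Fin (2 + k) → EdgeState
  edgeState i = stateOf D (p (inject₁ i)) (p (suc i))

  Blocked : Set
  Blocked = ∀ (i : Fin (2 + k)) → Undirected G D (p (inject₁ i)) (p (suc i)) →
    CreatesSinkOrSource G D (p (inject₁ i)) (p (suc i)) ×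
    CreatesSinkOrSource G D (p (suc i)) (p (inject₁ i))

  vtx-two-apart : ∀ (j : Fin (suc k)) → p (inject₁ (inject₁ j)) ≢ p (suc (suc j))
  vtx-two-apart j = inject₁²≢suc² j ∘ distinct P

  numUndirected≡countUndirected : numUndirected G D P ≡ countUndirected edgeState
  numUndirected≡countUndirected =
    count-cong {g = isUndirected ∘ edgeState} λ i → sym (isUndirected-stateOf (adjacent P i))

  neighbours-compatible : (∀ i → Internal i → degree G (p i) ≡ 2) →
    NeighboursCompatible edgeState
  neighbours-compatible deg j =
    compatible-at-degree-two ns (deg (suc (inject₁ j)) internal)
      (adj-sym (adjacent P (inject₁ j))) (adjacent P (suc j)) (vtx-two-apart j)
    where
    internal : Internal (suc (inject₁ j))
    internal = (λ ()) , λ eq → fromℕ≢inject₁ (sym (suc-injective eq))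

  between-opposites : Blocked → UndirectedBetweenOpposites edgeState
  between-opposites blocked j eU =
    blocked-between-opposites ns po
      (blocked (suc (inject₁ j)) (undirected-stateOf (adjacent P (suc (inject₁ j))) eU))
      (adj-sym (adjacent P (inject₁ (inject₁ j)))) (vtx-two-apart (inject₁ j))
      (adjacent P (suc (suc j))) (vtx-two-apart (suc j) ∘ sym)

  begins : Blocked → ∀ {s} → Signal G D (p zero) (p (suc zero)) s →
    Begins edgeState (opp (signDir s))
  begins blocked (explicit-in in₀)  = inj₁ (arcState-backward (proj₂ po _ _) in₀)
  begins blocked (explicit-out out₀) = inj₁ (arcState-forward out₀)
  begins blocked (implicit-in u other inᵘ) =
    inj₂ (stateOf-undirected u , arcState-backward (proj₂ po _ _)
      (othersIn-across ns po (proj₁ (blocked zero u)) other inᵘ _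
        (vtx-two-apart zero ∘ sym) (adjacent P (suc zero))))
  begins blocked (implicit-out u other outᵘ) =
    inj₂ (stateOf-undirected u , arcState-forward
      (othersOut-across ns po (proj₂ (blocked zero u)) other outᵘ _
        (vtx-two-apart zero ∘ sym) (adjacent P (suc zero))))

  ends : Blocked → ∀ {s} →
    Signal G D (p (fromℕ (2 + k))) (p (inject₁ (fromℕ (suc k)))) s →
    Ends edgeState (signDir s)
  ends blocked (explicit-in inᵥ)  = inj₁ (arcState-forward inᵥ)
  ends blocked (explicit-out outᵥ) = inj₁ (arcState-backward (proj₂ po _ _) outᵥ)
  ends blocked (implicit-in u other inᵛ) =
    inj₂ (stateOf-undirected (undirected-sym u) , arcState-forward
      (othersIn-across ns po (proj₂ (blocked (fromℕ (suc k)) (undirected-sym u))) other inᵛ _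
        (vtx-two-apart (fromℕ k)) (adj-sym (adjacent P (inject₁ (fromℕ k))))))
  ends blocked (implicit-out u other outᵛ) =
    inj₂ (stateOf-undirected (undirected-sym u) , arcState-backward (proj₂ po _ _)
      (othersOut-across ns po (proj₁ (blocked (fromℕ (suc k)) (undirected-sym u))) other outᵛ _
        (vtx-two-apart (fromℕ k)) (adj-sym (adjacent P (inject₁ (fromℕ k))))))

lemma2 : ∀ {n} (G : Graph n) (m : ℕ) (P : Path G (4 + m))
    (u u' v v' : Fin n) →
    u ≡ vtx P zero → u' ≡ vtx P (suc zero) →
    v ≡ vtx P (fromℕ (4 + m)) → v' ≡ vtx P (inject₁ (fromℕ (3 + m))) →
    (∀ i → Internal i → degree G (vtx P i) ≡ 2) →
    (D : Arcs n) → IsPartialOrientation G D → NoSinkNoSource G D →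
    (∀ (i : Fin (4 + m)) →
      Undirected G D (vtx P (inject₁ i)) (vtx P (suc i)) →
      CreatesSinkOrSource G D (vtx P (inject₁ i)) (vtx P (suc i)) ×
      CreatesSinkOrSource G D (vtx P (suc i)) (vtx P (inject₁ i))) →
    (Undirected G D u u' → OthersIn G D u u' ⊎ OthersOut G D u u') →
    (Undirected G D v v' → OthersIn G D v v' ⊎ OthersOut G D v v') →
    (su sv : Sign) → Signal G D u u' su → Signal G D v v' sv →
    (su ≡ sv → Odd (numUndirected G D P)) ×
    (su ≢ sv → Even (numUndirected G D P))
lemma2 G m P u u' v v' refl refl refl refl deg D po ns blocked _ _ su sv sigᵤ sigᵥ =
    proj₁ parity ∘ cong signDir
  , λ su≢sv → proj₂ parity (su≢sv ∘ signDir-injective)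
  where
  open PathStates po ns P
  reversals : oppⁿ (numUndirected G D P) (opp (signDir su)) ≡ signDir sv
  reversals =
    trans (cong (λ r → oppⁿ r (opp (signDir su))) numUndirected≡countUndirected)
          (oppⁿ-undirected edgeState (neighbours-compatible deg) (between-opposites blocked)
            (begins blocked sigᵤ) (ends blocked sigᵥ))
  parity : (signDir su ≡ signDir sv → Odd (numUndirected G D P)) ×
           (signDir su ≢ signDir sv → Even (numUndirected G D P))
  parity = oppⁿ-parity (numUndirected G D P) reversals
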